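{- Let $n\ge5$ be odd, $T=\langle n,3n-2,3n-1\rangle$, $\mathrm F(T)=\max(\mathbb Z\setminus T)$ and $S=T\cup\{\mathrm F(T)\}$. Then exactly $6n-13$ elements $s\in\mathrm{Ap}(S,\mathrm F(T))$ satisfy $\#\mathsf Z(s)=1$.
   Context: For $m\in S\setminus\{0\}$, $\mathrm{Ap}(S,m)=\{s\in S: s-m\notin S\}$. For $s\in\mathrm{Ap}(S,\mathrm F(T))$ (such $s$ lie in $T$), $\mathsf Z(s)=\{(x,y,z)\in\mathbb N^3: xn+y(3n-2)+z(3n-1)=s\}$. -}

module Defs where

open import Data.Nat using (ℕ; _+_; _*_; _∸_; _<_)
open import Data.Product using (Σ; ∃; _×_; _,_)
open import Data.Sum using (_⊎_)
open import Data.List using (List)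
open import Relation.Nullary using (¬_)
open import Relation.Binary.PropositionalEquality using (_≡_)

-- Generators of T = ⟨ n , 3n-2 , 3n-1 ⟩ (truncated subtraction; n ≥ 5 in use).
g₁ g₂ g₃ : ℕ → ℕ
g₁ n = n
g₂ n = 3 * n ∸ 2
g₃ n = 3 * n ∸ 1

Triple : Set
Triple = ℕ × ℕ × ℕ

IsFact : ℕ → ℕ → Triple → Set
IsFact n s (x , y , z) = x * g₁ n + y * g₂ n + z * g₃ n ≡ s

InT : ℕ → ℕ → Set
InT n s = ∃ λ (t : Triple) → IsFact n s t

-- F is the Frobenius number of T: F ∉ T and every integer > F lies in T
-- (negative integers are never in T, and F ≥ 1 since 1 ∉ T, so F ∈ ℕ).
IsFrobenius : ℕ → ℕ → Set
IsFrobenius n F = ¬ InT n F × (∀ m → F < m → InT n m)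

InS : ℕ → ℕ → ℕ → Set
InS n F s = InT n s ⊎ s ≡ F

-- s ∈ Ap(S, F) : s ∈ S and s - F ∉ S  (s - F ∈ S means s = k + F for some k ∈ S)
InAp : ℕ → ℕ → ℕ → Set
InAp n F s = InS n F s × ¬ (∃ λ k → k + F ≡ s × InS n F k)

UniqueFact : ℕ → ℕ → Set
UniqueFact n s = ∃ λ (t : Triple) → IsFact n s t × (∀ u → IsFact n s u → u ≡ t)

module Submission where

-- Write n = 5 + 2m, so T = ⟨a , b , c⟩ with a = n, b = 3n − 2 = 13 + 6m, c = 3n − 1 = 14 + 6m.
-- The triple (x , y , z) has value x a + y b + z c = Q n − r, where Q = x + 3y + 3z is its
-- level and r = 2y + z its defect, and always 3r ≤ 2Q.  If s = Q n − r with r < n and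
-- 2Q + 3 ≤ 3(r + n), then this is the only way of writing s = P n − ρ with 3ρ ≤ 2P (a larger
-- quotient forces ρ ≥ r + n, which is too big).  So the value of a triple satisfying these bounds
-- determines its level and defect, and these determine the triple once z ≤ 1 and (y = 0 or x ≤ 2).
-- F = (5 + 3m) n − (3 + 2m) is of this form but no triple has that level and defect, while
-- explicit factorizations cover F + 1, …, F + n.  The relations 2c = 3a + b and
-- (3 + m) b = (5 + 3m) a + c produce second factorizations, and four relations g + F ∈ T show
-- s − F ∈ T; what survives is an explicit family of 17 + 12m triples, sorted by defect.

open import Defs
open import Data.Empty using (⊥; ⊥-elim)
open import Data.List using (List; []; _∷_; _++_; map; upTo; length)
open import Data.List.Properties using (length-++; length-map; length-upTo)
open import Data.List.Membership.Propositional using (_∈_)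
open import Data.List.Membership.Propositional.Properties
  using (∈-map⁺; ∈-map⁻; ∈-upTo⁺; ∈-upTo⁻; ∈-++⁺ˡ; ∈-++⁺ʳ; ∈-++⁻)
open import Data.List.Relation.Unary.All using (All; []; _∷_)
import Data.List.Relation.Unary.All as All
import Data.List.Relation.Unary.All.Properties as All
open import Data.List.Relation.Unary.AllPairs using ([]; _∷_)
open import Data.List.Relation.Unary.Any using (here; there)
open import Data.List.Relation.Unary.Unique.Propositional using (Unique)
open import Data.List.Relation.Unary.Unique.Propositional.Properties using (++⁺; upTo⁺)
import Data.List.Relation.Unary.Unique.Propositional.Properties as Unique
open import Data.Nat using (ℕ; zero; suc; _+_; _*_; _∸_; _≤_; _<_; z≤n; s≤s; s≤s⁻¹; _<?_)
open import Data.Nat.Divisibility using (_∣_; divides)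
open import Data.Nat.DivMod using (_/_; _%_; m≡m%n+[m/n]*n; m%n<n)
open import Data.Nat.Properties
open import Data.Nat.Tactic.RingSolver using (solve-∀)
open import Data.Product using (Σ; ∃; _×_; _,_; proj₁; proj₂; map₁; uncurry)
open import Data.Sum using (_⊎_; inj₁; inj₂)
import Data.Sum as Sum
open import Function.Bundles using (_⇔_; mk⇔)
open import Relation.Binary.Definitions using (tri<; tri≈; tri>)
open import Relation.Binary.PropositionalEquality
open import Relation.Nullary using (¬_; yes; no; contradiction)

<-by-contradiction : ∀ {k x} → (∀ d → x ≡ k + d → ⊥) → x < k
<-by-contradiction {k} {x} x≢k+d with x <? k
... | yes x<k = x<k
... | no x≮k with m≤n⇒∃[o]m+o≡n (≮⇒≥ x≮k)
...   | d , k+d≡x = ⊥-elim (x≢k+d d (sym k+d≡x))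

quotient-shift : ∀ N {A B a b} → a < N → A * N + a ≡ B * N + b →
                 ∃ λ j → A ≡ B + j × b ≡ a + j * N
quotient-shift N {zero} {zero} _ a≡b = 0 , refl , trans (sym a≡b) (sym (+-identityʳ _))
quotient-shift N {zero} {suc B} {b = b} a<N a≡ =
  ⊥-elim (<⇒≱ a<N (subst (N ≤_) (sym a≡) (≤-trans (m≤m+n N (B * N)) (m≤m+n _ b))))
quotient-shift N {suc A} {zero} {a} _ eq = suc A , refl , trans (sym eq) (+-comm (N + A * N) a)
quotient-shift N {suc A} {suc B} {a} {b} a<N eq
  with quotient-shift N a<N (+-cancelˡ-≡ N _ _ (trans (sym (+-assoc N (A * N) a)) (trans eq (+-assoc N (B * N) b))))
... | j , A≡B+j , b≡a+jN = j , cong suc A≡B+j , b≡a+jN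

2y+z≤2n : ∀ y z {n} → y + z ≤ n → 2 * y + z ≤ 2 * n
2y+z≤2n y z {n} y+z≤n = begin
  2 * y + z       ≤⟨ +-monoʳ-≤ (2 * y) (m≤m+n z (z + 0)) ⟩
  2 * y + 2 * z   ≡⟨ *-distribˡ-+ 2 y z ⟨
  2 * (y + z)     ≤⟨ *-monoʳ-≤ 2 y+z≤n ⟩
  2 * n           ∎
  where open ≤-Reasoning

2y+z≤2n⇒y+z≤n : ∀ {y z n} → z ≤ 1 → 2 * y + z ≤ 2 * n → y + z ≤ n
2y+z≤2n⇒y+z≤n {y} {n = n} z≤n 2y≤2n =
  subst (_≤ n) (sym (+-identityʳ y)) (*-cancelˡ-≤ 2 (subst (_≤ 2 * n) (+-identityʳ _) 2y≤2n))
2y+z≤2n⇒y+z≤n {y} {n = n} (s≤s z≤n) 2y+1≤2n =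
  subst (_≤ n) (+-comm 1 y) (*-cancelˡ-< 2 y n (subst (_≤ 2 * n) (+-comm (2 * y) 1) 2y+1≤2n))

halve : ℕ → ℕ × ℕ
halve zero = 0 , 0
halve (suc zero) = 0 , 1
halve (suc (suc r)) = map₁ suc (halve r)

halve-spec : ∀ r → 2 * proj₁ (halve r) + proj₂ (halve r) ≡ r × proj₂ (halve r) ≤ 1
halve-spec zero = refl , z≤n
halve-spec (suc zero) = refl , s≤s z≤n
halve-spec (suc (suc r)) with halve-spec r
... | 2q+b≡r , b≤1 = trans (cong (_+ proj₂ (halve r)) (*-suc 2 (proj₁ (halve r)))) (cong (2 +_) 2q+b≡r) , b≤1

halve-unique : ∀ q {b} → b ≤ 1 → halve (2 * q + b) ≡ (q , b)
halve-unique zero z≤n = refl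
halve-unique zero (s≤s z≤n) = refl
halve-unique (suc q) {b} b≤1 =
  trans (cong (λ r → halve (r + b)) (*-suc 2 q)) (cong (map₁ suc) (halve-unique q b≤1))

map⁺-injectiveOn : ∀ {A B : Set} {P : A → Set} {f : A → B} {xs : List A} →
                   (∀ {x y} → P y → f x ≡ f y → x ≡ y) → All P xs → Unique xs → Unique (map f xs)
map⁺-injectiveOn inj [] [] = []
map⁺-injectiveOn inj (_ ∷ pxs) (x∉xs ∷ unique) =
  All.map⁺ (All.zipWith (λ (x≢y , py) fx≡fy → x≢y (inj py fx≡fy)) (x∉xs , pxs)) ∷ map⁺-injectiveOn inj pxs unique

-- Representations s = P N − ρ

record WeakRep (N s P ρ : ℕ) : Set where
  constructor weakRep
  field
    equation : s + ρ ≡ P * N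
    bound    : 3 * ρ ≤ 2 * P

record CanonicalRep (N s Q r : ℕ) : Set where
  constructor canonicalRep
  field
    equation : s + r ≡ Q * N
    r<N      : r < N
    slack    : 2 * Q + 3 ≤ 3 * (r + N)

weakRep-+ : ∀ {N s s′ P P′ ρ ρ′} → WeakRep N s P ρ → WeakRep N s′ P′ ρ′ →
            WeakRep N (s + s′) (P + P′) (ρ + ρ′)
weakRep-+ {N} {s} {s′} {P} {P′} {ρ} {ρ′} (weakRep s+ρ≡PN 3ρ≤2P) (weakRep s′+ρ′≡P′N 3ρ′≤2P′) =
  weakRep sum≡ sum≤
  where
  sum≡ : s + s′ + (ρ + ρ′) ≡ (P + P′) * N
  sum≡ = begin
    s + s′ + (ρ + ρ′)     ≡⟨ +-interchange s s′ ρ ρ′ ⟩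
    (s + ρ) + (s′ + ρ′)   ≡⟨ cong₂ _+_ s+ρ≡PN s′+ρ′≡P′N ⟩
    P * N + P′ * N        ≡⟨ *-distribʳ-+ N P P′ ⟨
    (P + P′) * N          ∎
    where
    open ≡-Reasoning
    +-interchange : ∀ s s′ ρ ρ′ → s + s′ + (ρ + ρ′) ≡ (s + ρ) + (s′ + ρ′)
    +-interchange = solve-∀
  sum≤ : 3 * (ρ + ρ′) ≤ 2 * (P + P′)
  sum≤ = begin
    3 * (ρ + ρ′)          ≡⟨ *-distribˡ-+ 3 ρ ρ′ ⟩
    3 * ρ + 3 * ρ′        ≤⟨ +-mono-≤ 3ρ≤2P 3ρ′≤2P′ ⟩
    2 * P + 2 * P′        ≡⟨ *-distribˡ-+ 2 P P′ ⟨
    2 * (P + P′)          ∎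
    where open ≤-Reasoning

excess-impossible : ∀ {N Q r} j → 0 < N → 2 * Q + 3 ≤ 3 * (r + N) →
                    3 * (r + suc j * N) ≤ 2 * (Q + suc j) → ⊥
excess-impossible {N} {Q} {r} j N>0 slack excess =
  <⇒≱ 2+2j<3+3jN (+-cancelˡ-≤ (2 * Q + 3 * (r + N)) _ _ combined)
  where
  combined : 2 * Q + 3 * (r + N) + (3 + 3 * (j * N)) ≤ 2 * Q + 3 * (r + N) + (2 + 2 * j)
  combined = subst₂ _≤_ (lhs N Q r j) (rhs N Q r j) (+-mono-≤ excess slack)
    where
    lhs : ∀ N Q r j → 3 * (r + suc j * N) + (2 * Q + 3) ≡ 2 * Q + 3 * (r + N) + (3 + 3 * (j * N))
    lhs = solve-∀
    rhs : ∀ N Q r j → 2 * (Q + suc j) + 3 * (r + N) ≡ 2 * Q + 3 * (r + N) + (2 + 2 * j)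
    rhs = solve-∀
  j≤jN : j ≤ j * N
  j≤jN = ≤-trans (≤-reflexive (sym (*-identityʳ j))) (*-monoʳ-≤ j N>0)
  2+2j<3+3jN : 2 + 2 * j < 3 + 3 * (j * N)
  2+2j<3+3jN = s≤s (+-monoʳ-≤ 2 (≤-trans (*-monoʳ-≤ 2 j≤jN) (*-monoˡ-≤ (j * N) {2} {3} (s≤s (s≤s z≤n)))))

canonical-unique : ∀ {N s Q r P ρ} → CanonicalRep N s Q r → WeakRep N s P ρ → P ≡ Q × ρ ≡ r
canonical-unique {N} {s} {Q} {r} {P} {ρ} (canonicalRep s+r≡QN r<N slack) (weakRep s+ρ≡PN 3ρ≤2P)
  with quotient-shift N r<N PN+r≡QN+ρ
  where
  PN+r≡QN+ρ : P * N + r ≡ Q * N + ρ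
  PN+r≡QN+ρ = begin
    P * N + r   ≡⟨ cong (_+ r) s+ρ≡PN ⟨
    s + ρ + r   ≡⟨ +-swapʳ s ρ r ⟩
    s + r + ρ   ≡⟨ cong (_+ ρ) s+r≡QN ⟩
    Q * N + ρ   ∎
    where
    open ≡-Reasoning
    +-swapʳ : ∀ s ρ r → s + ρ + r ≡ s + r + ρ
    +-swapʳ = solve-∀
... | zero , P≡Q+0 , ρ≡r+0 = trans P≡Q+0 (+-identityʳ Q) , trans ρ≡r+0 (+-identityʳ r)
... | suc j , refl , refl = ⊥-elim (excess-impossible {Q = Q} {r = r} j (≤-trans (s≤s z≤n) r<N) slack 3ρ≤2P)

level defect : Triple → ℕ
level (x , y , z) = x + 3 * y + 3 * z
defect (x , y , z) = 2 * y + z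

3*defect≤2*level : ∀ t → 3 * defect t ≤ 2 * level t
3*defect≤2*level (x , y , z) = subst (3 * (2 * y + z) ≤_) (rearrange x y z) (m≤m+n _ (2 * x + 3 * z))
  where
  rearrange : ∀ x y z → 3 * (2 * y + z) + (2 * x + 3 * z) ≡ 2 * (x + 3 * y + 3 * z)
  rearrange = solve-∀

Rigid : Triple → Set
Rigid (x , y , z) = z ≤ 1 × (y ≡ 0 ⊎ x ≤ 2)

-- Equal level and defect differ by a multiple of (3 , 1 , −2); rigidity forbids both directions.
rigid-determined : ∀ {t u} → Rigid t → level u ≡ level t → defect u ≡ defect t → u ≡ t
rigid-determined {x , y , z} {x′ , y′ , z′} _ level≡ defect≡ with <-cmp y′ y
... | tri≈ _ refl _ with +-cancelˡ-≡ (2 * y) z′ z defect≡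
...   | refl with +-cancelʳ-≡ (3 * y) x′ x (+-cancelʳ-≡ (3 * z) _ _ level≡)
...     | refl = refl
rigid-determined {x , y , z} {x′ , y′ , z′} (z≤1 , _) level≡ defect≡ | tri> _ _ y<y′
  with m≤n⇒∃[o]m+o≡n y<y′
... | d , refl = ⊥-elim (≤⇒≯ z≤1 (subst (1 <_) 2+2d+z′≡z (s≤s (s≤s z≤n))))
  where
  rearrange : ∀ y d z′ → 2 * (suc y + d) + z′ ≡ 2 * y + (2 + 2 * d + z′)
  rearrange = solve-∀
  2+2d+z′≡z : 2 + 2 * d + z′ ≡ z
  2+2d+z′≡z = +-cancelˡ-≡ (2 * y) _ z (trans (sym (rearrange y d z′)) defect≡)
rigid-determined {x , y , z} {x′ , y′ , z′} (_ , y≡0⊎x≤2) level≡ defect≡ | tri< y′<y _ _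
  with m≤n⇒∃[o]m+o≡n y′<y
... | d , refl with +-cancelˡ-≡ (2 * y′) z′ _ (trans defect≡ (rearrange y′ d z))
  where
  rearrange : ∀ y d z → 2 * (suc y + d) + z ≡ 2 * y + (2 + 2 * d + z)
  rearrange = solve-∀
...   | refl
  with +-cancelʳ-≡ (3 * (suc y′ + d)) (x′ + 3 + 3 * d) x
         (+-cancelʳ-≡ (3 * z) _ _ (trans (sym (rearrange x′ y′ d z)) level≡))
  where
  rearrange : ∀ x y d z → x + 3 * y + 3 * (2 + 2 * d + z) ≡ x + 3 + 3 * d + 3 * (suc y + d) + 3 * z
  rearrange = solve-∀
...     | refl with y≡0⊎x≤2
...       | inj₂ x≤2 = ⊥-elim (≤⇒≯ x≤2 (≤-trans (m≤n+m 3 x′) (m≤m+n _ (3 * d))))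

-- Relations in T, with a = 5 + 2m, b = 13 + 6m, c = 14 + 6m and F = 22 + 23m + 6m² written out.

2c≈3a+b : ∀ m x y z →
  x * (5 + 2 * m) + y * (13 + 6 * m) + (2 + z) * (14 + 6 * m)
  ≡ (3 + x) * (5 + 2 * m) + (1 + y) * (13 + 6 * m) + z * (14 + 6 * m)
2c≈3a+b = solve-∀

[3+m]b≈[5+3m]a+c : ∀ m x y z →
  x * (5 + 2 * m) + (3 + m + y) * (13 + 6 * m) + z * (14 + 6 * m)
  ≡ (5 + 3 * m + x) * (5 + 2 * m) + y * (13 + 6 * m) + (1 + z) * (14 + 6 * m)
[3+m]b≈[5+3m]a+c = solve-∀

b+F≈[7+3m]a : ∀ m x →
  x * (5 + 2 * m) + 1 * (13 + 6 * m) + 0 * (14 + 6 * m) + (22 + 23 * m + 6 * (m * m))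
  ≡ (7 + 3 * m + x) * (5 + 2 * m) + 0 * (13 + 6 * m) + 0 * (14 + 6 * m)
b+F≈[7+3m]a = solve-∀

c+F≈2a+[2+m]b : ∀ m →
  0 * (5 + 2 * m) + 0 * (13 + 6 * m) + 1 * (14 + 6 * m) + (22 + 23 * m + 6 * (m * m))
  ≡ 2 * (5 + 2 * m) + (2 + m) * (13 + 6 * m) + 0 * (14 + 6 * m)
c+F≈2a+[2+m]b = solve-∀

a+F≈[1+m]b+c : ∀ m x →
  (1 + x) * (5 + 2 * m) + 0 * (13 + 6 * m) + 0 * (14 + 6 * m) + (22 + 23 * m + 6 * (m * m))
  ≡ x * (5 + 2 * m) + (1 + m) * (13 + 6 * m) + 1 * (14 + 6 * m)
a+F≈[1+m]b+c = solve-∀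

a+b+F≈[2+m]b+c : ∀ m x →
  (1 + x) * (5 + 2 * m) + 1 * (13 + 6 * m) + 0 * (14 + 6 * m) + (22 + 23 * m + 6 * (m * m))
  ≡ x * (5 + 2 * m) + (2 + m) * (13 + 6 * m) + 1 * (14 + 6 * m)
a+b+F≈[2+m]b+c = solve-∀

module _ (m : ℕ) where

  a b c F : ℕ
  a = 5 + 2 * m
  b = 13 + 6 * m
  c = 14 + 6 * m
  F = 22 + 23 * m + 6 * (m * m)

  value : Triple → ℕ
  value (x , y , z) = x * a + y * b + z * c

  value-weakRep : ∀ t → WeakRep a (value t) (level t) (defect t)
  value-weakRep (x , y , z) = weakRep (value+defect≡level*a m x y z) (3*defect≤2*level (x , y , z))
    where
    value+defect≡level*a : ∀ m x y z →
      x * (5 + 2 * m) + y * (13 + 6 * m) + z * (14 + 6 * m) + (2 * y + z) ≡ (x + 3 * y + 3 * z) * (5 + 2 * m)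
    value+defect≡level*a = solve-∀

  F-canonicalRep : CanonicalRep a F (5 + 3 * m) (3 + 2 * m)
  F-canonicalRep =
    canonicalRep (F+[3+2m]≡[5+3m]a m) (+-monoˡ-< (2 * m) {3} {5} (s≤s (s≤s (s≤s (s≤s z≤n)))))
                 (subst (2 * (5 + 3 * m) + 3 ≤_) (slack m) (m≤m+n _ (11 + 6 * m)))
    where
    F+[3+2m]≡[5+3m]a : ∀ m → 22 + 23 * m + 6 * (m * m) + (3 + 2 * m) ≡ (5 + 3 * m) * (5 + 2 * m)
    F+[3+2m]≡[5+3m]a = solve-∀
    slack : ∀ m → 2 * (5 + 3 * m) + 3 + (11 + 6 * m) ≡ 3 * (3 + 2 * m + (5 + 2 * m))
    slack = solve-∀

  F-weakRep : WeakRep a F (5 + 3 * m) (3 + 2 * m)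
  F-weakRep =
    weakRep (CanonicalRep.equation F-canonicalRep) (subst (3 * (3 + 2 * m) ≤_) (bound m) (m≤m+n _ 1))
    where
    bound : ∀ m → 3 * (3 + 2 * m) + 1 ≡ 2 * (5 + 3 * m)
    bound = solve-∀

  no-triple-at-F : ∀ {x y z} → x + 3 * y + 3 * z ≡ 5 + 3 * m → 2 * y + z ≡ 3 + 2 * m → ⊥
  no-triple-at-F {x} {y} {z} level≡ defect≡ with y + z ≤? suc m
  ... | yes y+z≤1+m = <-irrefl refl (begin-strict
    2 + 2 * m        <⟨ n<1+n _ ⟩
    3 + 2 * m        ≡⟨ defect≡ ⟨
    2 * y + z        ≤⟨ 2y+z≤2n y z y+z≤1+m ⟩
    2 * suc m        ≡⟨ *-suc 2 m ⟩
    2 + 2 * m        ∎)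
    where open ≤-Reasoning
  ... | no y+z≰1+m = <-irrefl refl (begin-strict
    5 + 3 * m            <⟨ n<1+n _ ⟩
    6 + 3 * m            ≡⟨ *-distribˡ-+ 3 2 m ⟨
    3 * (2 + m)          ≤⟨ *-monoʳ-≤ 3 (≰⇒> y+z≰1+m) ⟩
    3 * (y + z)          ≡⟨ *-distribˡ-+ 3 y z ⟩
    3 * y + 3 * z        ≤⟨ m≤n+m _ x ⟩
    x + (3 * y + 3 * z)  ≡⟨ +-assoc x (3 * y) (3 * z) ⟨
    x + 3 * y + 3 * z    ≡⟨ level≡ ⟩
    5 + 3 * m            ∎)
    where open ≤-Reasoning

  value≢F : ∀ u → value u ≢ F
  value≢F u@(x , y , z) value≡F =
    uncurry (no-triple-at-F {x} {y} {z})
      (canonical-unique F-canonicalRep (subst (λ s → WeakRep a s (level u) (defect u)) value≡F (value-weakRep u)))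

  Factorizable : ℕ → Set
  Factorizable s = ∃ λ u → value u ≡ s

  factorizable-+a : ∀ {s} → Factorizable s → Factorizable (s + a)
  factorizable-+a ((x , y , z) , refl) = (suc x , y , z) , value-suc m x y z
    where
    value-suc : ∀ m x y z → (1 + x) * (5 + 2 * m) + y * (13 + 6 * m) + z * (14 + 6 * m)
                           ≡ x * (5 + 2 * m) + y * (13 + 6 * m) + z * (14 + 6 * m) + (5 + 2 * m)
    value-suc = solve-∀

  factorizable-+qa : ∀ q {s} → Factorizable s → Factorizable (s + q * a)
  factorizable-+qa zero {s} s∈T = subst Factorizable (sym (+-identityʳ s)) s∈T
  factorizable-+qa (suc q) {s} s∈T =
    subst Factorizable (+-assoc s a (q * a)) (factorizable-+qa q (factorizable-+a s∈T))

  even-window : ∀ q → 2 * q + 0 < a → Factorizable (suc (F + (2 * q + 0)))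
  even-window q _ with ≤-<-connex q m
  ... | inj₁ q≤m with m≤n⇒∃[o]m+o≡n q≤m
  ...   | y , refl = (2 + 3 * q , suc y , 0) , witness q y
    where
    witness : ∀ q y → (2 + 3 * q) * (5 + 2 * (q + y)) + suc y * (13 + 6 * (q + y)) + 0 * (14 + 6 * (q + y))
                      ≡ suc (22 + 23 * (q + y) + 6 * ((q + y) * (q + y)) + (2 * q + 0))
    witness = solve-∀
  even-window q lt | inj₂ m<q with m≤n⇒∃[o]m+o≡n m<q
  ... | 0 , refl = (5 + 3 * m , 0 , 0) , witness m
    where
    witness : ∀ m → (5 + 3 * m) * (5 + 2 * m) + 0 * (13 + 6 * m) + 0 * (14 + 6 * m)
                    ≡ suc (22 + 23 * m + 6 * (m * m) + (2 * (suc m + 0) + 0))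
    witness = solve-∀
  ... | 1 , refl = (0 , suc m , 1) , witness m
    where
    witness : ∀ m → 0 * (5 + 2 * m) + suc m * (13 + 6 * m) + 1 * (14 + 6 * m)
                    ≡ suc (22 + 23 * m + 6 * (m * m) + (2 * (suc m + 1) + 0))
    witness = solve-∀
  ... | suc (suc e) , refl = ⊥-elim (<⇒≱ lt (subst (a ≤_) (sym (excess m e)) (m≤m+n a _)))
    where
    excess : ∀ m e → 2 * (suc m + suc (suc e)) + 0 ≡ 5 + 2 * m + (1 + 2 * e)
    excess = solve-∀

  odd-window : ∀ q → 2 * q + 1 < a → Factorizable (suc (F + (2 * q + 1)))
  odd-window q _ with ≤-<-connex q m
  ... | inj₁ q≤m with m≤n⇒∃[o]m+o≡n q≤m
  ...   | y , refl = (2 + 3 * q , y , 1) , witness q y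
    where
    witness : ∀ q y → (2 + 3 * q) * (5 + 2 * (q + y)) + y * (13 + 6 * (q + y)) + 1 * (14 + 6 * (q + y))
                      ≡ suc (22 + 23 * (q + y) + 6 * ((q + y) * (q + y)) + (2 * q + 1))
    witness = solve-∀
  odd-window q lt | inj₂ m<q with m≤n⇒∃[o]m+o≡n m<q
  ... | 0 , refl = (0 , 2 + m , 0) , witness m
    where
    witness : ∀ m → 0 * (5 + 2 * m) + (2 + m) * (13 + 6 * m) + 0 * (14 + 6 * m)
                    ≡ suc (22 + 23 * m + 6 * (m * m) + (2 * (suc m + 0) + 1))
    witness = solve-∀
  ... | suc e , refl = ⊥-elim (<⇒≱ lt (subst (a ≤_) (sym (excess m e)) (m≤m+n a _)))
    where
    excess : ∀ m e → 2 * (suc m + suc e) + 1 ≡ 5 + 2 * m + 2 * e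
    excess = solve-∀

  window : ∀ ρ → ρ < a → Factorizable (suc (F + ρ))
  window ρ _ with halve ρ | halve-spec ρ
  window _ ρ<a | q , 0 | refl , _ = even-window q ρ<a
  window _ ρ<a | q , 1 | refl , _ = odd-window q ρ<a
  window _ _ | q , suc (suc _) | _ , s≤s ()

  F-above : ∀ d → Factorizable (suc (F + d))
  F-above d =
    subst Factorizable (cong suc (trans (+-assoc F ρ (q * a)) (cong (F +_) (sym (m≡m%n+[m/n]*n d a)))))
          (factorizable-+qa q (window ρ (m%n<n d a)))
    where
    ρ q : ℕ
    ρ = d % a
    q = d / a

  -- Uniquely factorized elements of Ap(S, F)

  data Good : Triple → Set where
    base₀ : ∀ {x} → x < 7 + 3 * m → Good (x , 0 , 0)
    base₁ : ∀ {x} → x < 5 + 3 * m → Good (x , 0 , 1)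
    inner : ∀ {x y z} → x < 3 → z ≤ 1 → y + z ≤ m → Good (x , suc y , z)
    top   : ∀ {x} → x < 2 → Good (x , 2 + m , 0)

  good⇒rigid : ∀ {t} → Good t → Rigid t
  good⇒rigid (base₀ _) = z≤n , inj₁ refl
  good⇒rigid (base₁ _) = s≤s z≤n , inj₁ refl
  good⇒rigid (inner x<3 z≤1 _) = z≤1 , inj₂ (s≤s⁻¹ x<3)
  good⇒rigid (top x<2) = z≤n , inj₂ (≤-trans (s≤s⁻¹ x<2) (s≤s z≤n))

  good⇒x+2z≤6+3m : ∀ {x y z} → Good (x , y , z) → x + 2 * z ≤ 6 + 3 * m
  good⇒x+2z≤6+3m {x} (base₀ x<7+3m) = ≤-trans (≤-reflexive (+-identityʳ x)) (s≤s⁻¹ x<7+3m)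
  good⇒x+2z≤6+3m {x} (base₁ x<5+3m) = subst (_≤ 6 + 3 * m) (+-comm 2 x) (s≤s (s≤s (s≤s⁻¹ x<5+3m)))
  good⇒x+2z≤6+3m (inner x<3 z≤1 _) =
    ≤-trans (+-mono-≤ (s≤s⁻¹ x<3) (*-monoʳ-≤ 2 z≤1)) (m≤m+n 4 (2 + 3 * m))
  good⇒x+2z≤6+3m (top x<2) = ≤-trans (+-monoˡ-≤ 0 (s≤s⁻¹ x<2)) (s≤s z≤n)

  good⇒apéry-bound : ∀ {t} → Good t → defect t ≤ 2 + 2 * m ⊎ (defect t ≡ 4 + 2 * m × level t ≤ 7 + 3 * m)
  good⇒apéry-bound (base₀ _) = inj₁ z≤n
  good⇒apéry-bound (base₁ _) = inj₁ (s≤s z≤n)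
  good⇒apéry-bound {x , suc y , z} (inner _ _ y+z≤m) =
    inj₁ (subst (_≤ 2 + 2 * m) (sym (cong (_+ z) (*-suc 2 y))) (+-monoʳ-≤ 2 (2y+z≤2n y z y+z≤m)))
  good⇒apéry-bound {x , _ , _} (top x<2) =
    inj₂ (defect-top m , subst (_≤ 7 + 3 * m) (sym (level-top m x)) (+-monoˡ-≤ (6 + 3 * m) (s≤s⁻¹ x<2)))
    where
    defect-top : ∀ m → 2 * (2 + m) + 0 ≡ 4 + 2 * m
    defect-top = solve-∀
    level-top : ∀ m x → x + 3 * (2 + m) + 3 * 0 ≡ x + (6 + 3 * m)
    level-top = solve-∀

  good⇒defect<a : ∀ {t} → Good t → defect t < a
  good⇒defect<a g with good⇒apéry-bound g
  ... | inj₁ defect≤2+2m = ≤-trans (s≤s defect≤2+2m) (+-monoˡ-≤ (2 * m) {3} {5} (s≤s (s≤s (s≤s z≤n))))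
  ... | inj₂ (defect≡4+2m , _) = ≤-reflexive (cong suc defect≡4+2m)

  good⇒canonicalRep : ∀ {t} → Good t → CanonicalRep a (value t) (level t) (defect t)
  good⇒canonicalRep {t@(x , y , z)} g =
    canonicalRep (WeakRep.equation (value-weakRep t)) (good⇒defect<a g) (begin
      2 * (x + 3 * y + 3 * z) + 3               ≤⟨ m≤m+n _ z ⟩
      2 * (x + 3 * y + 3 * z) + 3 + z           ≡⟨ slack-identity x y z ⟩
      2 * (x + 2 * z) + (3 + 6 * y + 3 * z)     ≤⟨ +-monoˡ-≤ _ (*-monoʳ-≤ 2 (good⇒x+2z≤6+3m g)) ⟩
      2 * (6 + 3 * m) + (3 + 6 * y + 3 * z)     ≡⟨ slack-bound m y z ⟩
      3 * (2 * y + z + (5 + 2 * m))             ∎)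
    where
    open ≤-Reasoning
    slack-identity : ∀ x y z → 2 * (x + 3 * y + 3 * z) + 3 + z ≡ 2 * (x + 2 * z) + (3 + 6 * y + 3 * z)
    slack-identity = solve-∀
    slack-bound : ∀ m y z → 2 * (6 + 3 * m) + (3 + 6 * y + 3 * z) ≡ 3 * (2 * y + z + (5 + 2 * m))
    slack-bound = solve-∀

  UniquelyFactored : Triple → Set
  UniquelyFactored t = ∀ u → value u ≡ value t → u ≡ t

  MinusF∉T : Triple → Set
  MinusF∉T t = ∀ u → value u + F ≢ value t

  good⇒uniquelyFactored : ∀ {t} → Good t → UniquelyFactored t
  good⇒uniquelyFactored g u value≡ =
    uncurry (rigid-determined (good⇒rigid g))
      (canonical-unique (good⇒canonicalRep g) (subst (λ s → WeakRep a s (level u) (defect u)) value≡ (value-weakRep u)))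

  defect≡1⇒3≤level : ∀ u → defect u ≡ 1 → 3 ≤ level u
  defect≡1⇒3≤level (x , 0 , 1) _ = m≤n+m 3 (x + 0)
  defect≡1⇒3≤level (x , 0 , 0) ()
  defect≡1⇒3≤level (x , 0 , suc (suc z)) ()
  defect≡1⇒3≤level (x , 1 , z) ()
  defect≡1⇒3≤level (x , suc (suc y) , z) ()

  -- Subtracting F lowers the level by 5 + 3m and the defect by 3 + 2m.
  good⇒minusF∉S : ∀ {t} → Good t → ∀ k → k + F ≡ value t → Factorizable k ⊎ k ≡ F → ⊥
  good⇒minusF∉S {t} g k k+F≡value = refute
    where
    shifted : ∀ {P ρ} → WeakRep a k P ρ → P + (5 + 3 * m) ≡ level t × ρ + (3 + 2 * m) ≡ defect t
    shifted {P} {ρ} k-rep =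
      canonical-unique (good⇒canonicalRep g)
        (subst (λ s → WeakRep a s (P + (5 + 3 * m)) (ρ + (3 + 2 * m))) k+F≡value (weakRep-+ k-rep F-weakRep))
    refute : Factorizable k ⊎ k ≡ F → ⊥
    refute (inj₂ refl) =
      <⇒≱ (good⇒defect<a g) (subst (a ≤_) (proj₂ (shifted F-weakRep)) (subst (a ≤_) (sym (double m)) (m≤m+n a (1 + 2 * m))))
      where
      double : ∀ m → 3 + 2 * m + (3 + 2 * m) ≡ 5 + 2 * m + (1 + 2 * m)
      double = solve-∀
    refute (inj₁ (u , refl)) = from-bound (good⇒apéry-bound g)
      where
      level≡ : level u + (5 + 3 * m) ≡ level t
      level≡ = proj₁ (shifted (value-weakRep u))
      defect≡ : defect u + (3 + 2 * m) ≡ defect t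
      defect≡ = proj₂ (shifted (value-weakRep u))
      from-bound : defect t ≤ 2 + 2 * m ⊎ (defect t ≡ 4 + 2 * m × level t ≤ 7 + 3 * m) → ⊥
      from-bound (inj₁ defect≤2+2m) =
        <⇒≱ (s≤s defect≤2+2m) (subst (3 + 2 * m ≤_) defect≡ (m≤n+m (3 + 2 * m) (defect u)))
      from-bound (inj₂ (defect≡4+2m , level≤7+3m)) =
        <⇒≱ (s≤s level≤7+3m) (subst (8 + 3 * m ≤_) level≡ (+-monoˡ-≤ (5 + 3 * m) 3≤level))
        where
        3≤level : 3 ≤ level u
        3≤level = defect≡1⇒3≤level u (+-cancelʳ-≡ (3 + 2 * m) (defect u) 1 (trans defect≡ defect≡4+2m))

  unique⇒z≤1 : ∀ {x y z} → UniquelyFactored (x , y , z) → z ≤ 1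
  unique⇒z≤1 {z = 0} _ = z≤n
  unique⇒z≤1 {z = 1} _ = s≤s z≤n
  unique⇒z≤1 {x} {y} {suc (suc z)} unique =
    contradiction (unique (3 + x , 1 + y , z) (sym (2c≈3a+b m x y z))) λ ()

  unique⇒y≤2+m : ∀ {x y z} → UniquelyFactored (x , y , z) → y ≤ 2 + m
  unique⇒y≤2+m {x} {z = z} unique = s≤s⁻¹ (<-by-contradiction λ { d refl →
    contradiction (unique (5 + 3 * m + x , d , 1 + z) (sym ([3+m]b≈[5+3m]a+c m x d z))) λ () })

  unique⇒x<3 : ∀ {x y z} → UniquelyFactored (x , suc y , z) → x < 3
  unique⇒x<3 {y = y} {z} unique = <-by-contradiction λ { d refl →
    contradiction (unique (d , y , 2 + z) (2c≈3a+b m d y z)) λ () }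

  unique⇒x<5+3m : ∀ {x} → UniquelyFactored (x , 0 , 1) → x < 5 + 3 * m
  unique⇒x<5+3m unique = <-by-contradiction λ { d refl →
    contradiction (unique (d , 3 + m + 0 , 0) ([3+m]b≈[5+3m]a+c m d 0 0)) λ () }

  minusF∉T⇒x<7+3m : ∀ {x} → MinusF∉T (x , 0 , 0) → x < 7 + 3 * m
  minusF∉T⇒x<7+3m minusF∉T = <-by-contradiction λ { d refl → minusF∉T (d , 1 , 0) (b+F≈[7+3m]a m d) }

  minusF∉T⇒x<2 : ∀ {x} → x < 3 → MinusF∉T (x , 2 + m , 0) → x < 2
  minusF∉T⇒x<2 {0} _ _ = s≤s z≤n
  minusF∉T⇒x<2 {1} _ _ = s≤s (s≤s z≤n)
  minusF∉T⇒x<2 {2} _ minusF∉T = ⊥-elim (minusF∉T (0 , 0 , 1) (c+F≈2a+[2+m]b m))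
  minusF∉T⇒x<2 {suc (suc (suc _))} (s≤s (s≤s (s≤s ()))) _

  classify-top : ∀ {x y z} → UniquelyFactored (x , suc y , z) → MinusF∉T (x , suc y , z) →
                 m < y + z → Good (x , suc y , z)
  classify-top {x} {y} {0} unique minusF∉T m<y+0
    with ≤-antisym (s≤s⁻¹ (unique⇒y≤2+m unique)) (subst (suc m ≤_) (+-identityʳ y) m<y+0)
  ... | refl = top (minusF∉T⇒x<2 (unique⇒x<3 unique) minusF∉T)
  classify-top {x} {y} {1} unique minusF∉T m<y+1
    with m≤n⇒m<n∨m≡n (s≤s⁻¹ (subst (m <_) (+-comm y 1) m<y+1))
  ... | inj₂ m≡y =
    ⊥-elim (subst (λ y → MinusF∉T (x , suc y , 1)) (sym m≡y) minusF∉T (1 + x , 0 , 0) (a+F≈[1+m]b+c m x))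
  ... | inj₁ m<y with ≤-antisym (s≤s⁻¹ (unique⇒y≤2+m unique)) m<y
  ...   | refl = ⊥-elim (minusF∉T (1 + x , 1 , 0) (a+b+F≈[2+m]b+c m x))
  classify-top {z = suc (suc _)} unique _ _ = contradiction (unique⇒z≤1 unique) λ { (s≤s ()) }

  classify : ∀ {t} → UniquelyFactored t → MinusF∉T t → Good t
  classify {x , 0 , 0} _ minusF∉T = base₀ (minusF∉T⇒x<7+3m minusF∉T)
  classify {x , 0 , 1} unique _ = base₁ (unique⇒x<5+3m unique)
  classify {x , 0 , suc (suc z)} unique _ = contradiction (unique⇒z≤1 unique) λ { (s≤s ()) }
  classify {x , suc y , z} unique minusF∉T with y + z ≤? m
  ... | yes y+z≤m = inner (unique⇒x<3 unique) (unique⇒z≤1 unique) y+z≤m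
  ... | no y+z≰m = classify-top unique minusF∉T (≰⇒> y+z≰m)

  -- The good triples of defect r < 3 + 2m form the column r; the remaining two have defect 4 + 2m.

  width : ℕ → ℕ
  width 0 = 7 + 3 * m
  width 1 = 5 + 3 * m
  width (suc (suc _)) = 3

  column : ℕ → List Triple
  column r = map (_, halve r) (upTo (width r))

  columns : ℕ → List Triple
  columns zero = []
  columns (suc r) = column r ++ columns r

  topRow : List Triple
  topRow = (0 , 2 + m , 0) ∷ (1 , 2 + m , 0) ∷ []

  goodTriples : List Triple
  goodTriples = columns (3 + 2 * m) ++ topRow

  ∈-column⁺ : ∀ {r x} → x < width r → (x , halve r) ∈ column r
  ∈-column⁺ x<width = ∈-map⁺ _ (∈-upTo⁺ x<width)

  column-defect : ∀ {r t} → t ∈ column r → defect t ≡ r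
  column-defect {r} t∈column with ∈-map⁻ _ t∈column
  ... | _ , _ , refl = proj₁ (halve-spec r)

  ∈-columns⁻ : ∀ k {t} → t ∈ columns k → ∃ λ r → r < k × t ∈ column r
  ∈-columns⁻ (suc k) t∈columns with ∈-++⁻ (column k) t∈columns
  ... | inj₁ t∈column = k , ≤-refl , t∈column
  ... | inj₂ t∈columns′ with ∈-columns⁻ k t∈columns′
  ...   | r , r<k , t∈column = r , m<n⇒m<1+n r<k , t∈column

  ∈-columns⁺ : ∀ {k r t} → r < k → t ∈ column r → t ∈ columns k
  ∈-columns⁺ {suc k} r<1+k t∈column with m<1+n⇒m<n∨m≡n r<1+k
  ... | inj₁ r<k = ∈-++⁺ʳ (column k) (∈-columns⁺ r<k t∈column)
  ... | inj₂ refl = ∈-++⁺ˡ t∈column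

  columns-unique : ∀ k → Unique (columns k)
  columns-unique zero = []
  columns-unique (suc k) =
    ++⁺ (Unique.map⁺ (cong proj₁) (upTo⁺ (width k))) (columns-unique k) λ (t∈column , t∈columns) →
      let r , r<k , t∈column′ = ∈-columns⁻ k t∈columns
      in <-irrefl (trans (sym (column-defect t∈column′)) (column-defect t∈column)) r<k

  topRow-defect : ∀ {t} → t ∈ topRow → defect t ≡ 4 + 2 * m
  topRow-defect (here refl) = trans (+-identityʳ _) (*-distribˡ-+ 2 2 m)
  topRow-defect (there (here refl)) = trans (+-identityʳ _) (*-distribˡ-+ 2 2 m)

  goodTriples-unique : Unique goodTriples
  goodTriples-unique =
    ++⁺ (columns-unique (3 + 2 * m)) (((λ ()) ∷ []) ∷ [] ∷ []) λ (t∈columns , t∈topRow) →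
      let r , r<3+2m , t∈column = ∈-columns⁻ _ t∈columns
          r≡4+2m = trans (sym (column-defect t∈column)) (topRow-defect t∈topRow)
      in <-asym (n<1+n (3 + 2 * m)) (subst (_< 3 + 2 * m) r≡4+2m r<3+2m)

  column⇒∈ : ∀ {r t} → r < 3 + 2 * m → t ∈ column r → t ∈ goodTriples
  column⇒∈ r<3+2m t∈column = ∈-++⁺ˡ (∈-columns⁺ r<3+2m t∈column)

  good⇒∈ : ∀ {t} → Good t → t ∈ goodTriples
  good⇒∈ (base₀ x<7+3m) = column⇒∈ (s≤s z≤n) (∈-column⁺ {r = 0} x<7+3m)
  good⇒∈ (base₁ x<5+3m) = column⇒∈ (s≤s (s≤s z≤n)) (∈-column⁺ {r = 1} x<5+3m)
  good⇒∈ {x , suc y , z} (inner x<3 z≤1 y+z≤m) =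
    column⇒∈ (s≤s (s≤s (s≤s (2y+z≤2n y z y+z≤m))))
      (subst (λ p → (x , p) ∈ column (2 + (2 * y + z))) (cong (map₁ suc) (halve-unique y z≤1))
             (∈-column⁺ {r = 2 + (2 * y + z)} x<3))
  good⇒∈ (top {0} _) = ∈-++⁺ʳ (columns (3 + 2 * m)) (here refl)
  good⇒∈ (top {1} _) = ∈-++⁺ʳ (columns (3 + 2 * m)) (there (here refl))
  good⇒∈ (top {suc (suc _)} (s≤s (s≤s ())))

  column⇒good : ∀ r {t} → r < 3 + 2 * m → t ∈ column r → Good t
  column⇒good r r<3+2m t∈column with ∈-map⁻ _ t∈column
  ... | x , x∈upTo , refl = at r r<3+2m (∈-upTo⁻ x∈upTo)
    where
    at : ∀ r → r < 3 + 2 * m → x < width r → Good (x , halve r)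
    at 0 _ x<width = base₀ x<width
    at 1 _ x<width = base₁ x<width
    at (suc (suc r)) (s≤s (s≤s (s≤s r≤2m))) x<3 with halve-spec r
    ... | 2q+b≡r , b≤1 = inner x<3 b≤1 (2y+z≤2n⇒y+z≤n b≤1 (subst (_≤ 2 * m) (sym 2q+b≡r) r≤2m))

  ∈⇒good : ∀ {t} → t ∈ goodTriples → Good t
  ∈⇒good t∈ with ∈-++⁻ (columns (3 + 2 * m)) t∈
  ... | inj₁ t∈columns = let r , r<3+2m , t∈column = ∈-columns⁻ _ t∈columns in column⇒good r r<3+2m t∈column
  ... | inj₂ (here refl) = top (s≤s z≤n)
  ... | inj₂ (there (here refl)) = top (s≤s (s≤s z≤n))

  length-goodTriples : length goodTriples ≡ 17 + 12 * m
  length-goodTriples = begin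
    length (columns (3 + 2 * m) ++ topRow)   ≡⟨ length-++ (columns (3 + 2 * m)) ⟩
    length (columns (2 + (1 + 2 * m))) + 2   ≡⟨ cong (_+ 2) (length-columns (1 + 2 * m)) ⟩
    12 + 6 * m + 3 * (1 + 2 * m) + 2         ≡⟨ total m ⟩
    17 + 12 * m                              ∎
    where
    open ≡-Reasoning
    total : ∀ m → 12 + 6 * m + 3 * (1 + 2 * m) + 2 ≡ 17 + 12 * m
    total = solve-∀
    length-columns-suc : ∀ r → length (columns (suc r)) ≡ width r + length (columns r)
    length-columns-suc r =
      trans (length-++ (column r))
            (cong (_+ length (columns r)) (trans (length-map _ (upTo (width r))) (length-upTo (width r))))
    length-columns : ∀ k → length (columns (2 + k)) ≡ 12 + 6 * m + 3 * k
    length-columns zero = trans (length-columns-suc 1) (trans (cong (5 + 3 * m +_) (length-columns-suc 0)) (base m))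
      where
      base : ∀ m → 5 + 3 * m + (7 + 3 * m + 0) ≡ 12 + 6 * m + 3 * 0
      base = solve-∀
    length-columns (suc k) = trans (length-columns-suc (2 + k)) (trans (cong (3 +_) (length-columns k)) (step m k))
      where
      step : ∀ m k → 3 + (12 + 6 * m + 3 * k) ≡ 12 + 6 * m + 3 * (1 + k)
      step = solve-∀

  value-isFact : ∀ t → IsFact a (value t) t
  value-isFact (x , y , z) =
    cong₂ (λ g₂a g₃a → x * a + y * g₂a + z * g₃a) (cong (_∸ 2) (3a≡2+b m)) (cong (_∸ 1) (3a≡1+c m))
    where
    3a≡2+b : ∀ m → 3 * (5 + 2 * m) ≡ 2 + (13 + 6 * m)
    3a≡2+b = solve-∀
    3a≡1+c : ∀ m → 3 * (5 + 2 * m) ≡ 1 + (14 + 6 * m)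
    3a≡1+c = solve-∀

  isFact⇒value : ∀ {s} t → IsFact a s t → value t ≡ s
  isFact⇒value t isFact = trans (sym (value-isFact t)) isFact

  value⇒isFact : ∀ {s} t → value t ≡ s → IsFact a s t
  value⇒isFact t value≡s = trans (value-isFact t) value≡s

  isFrobenius : IsFrobenius a F
  isFrobenius = (λ (t , isFact) → value≢F t (isFact⇒value t isFact)) ,
                λ s F<s → subst (InT a) (proj₂ (m≤n⇒∃[o]m+o≡n F<s)) (above _)
    where
    above : ∀ d → InT a (suc F + d)
    above d = let u , value≡ = F-above d in u , value⇒isFact u value≡

  good⇒apéry×unique : ∀ {t} → Good t → InAp a F (value t) × UniqueFact a (value t)
  good⇒apéry×unique {t} g = (inj₁ (t , value⇒isFact t refl) , minusF∉S) , (t , value⇒isFact t refl , unique)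
    where
    minusF∉S : ¬ (∃ λ k → k + F ≡ value t × InS a F k)
    minusF∉S (k , k+F≡ , k∈S) =
      good⇒minusF∉S g k k+F≡ (Sum.map₁ (λ (u , isFact) → u , isFact⇒value u isFact) k∈S)
    unique : ∀ u → IsFact a (value t) u → u ≡ t
    unique u isFact = good⇒uniquelyFactored g u (isFact⇒value u isFact)

  apéry×unique⇒good : ∀ {s} → InAp a F s × UniqueFact a s → ∃ λ t → Good t × value t ≡ s
  apéry×unique⇒good {s} ((_ , s-F∉S) , (t , isFact , unique)) =
    t , classify uniquelyFactored minusF∉T , value≡s
    where
    value≡s : value t ≡ s
    value≡s = isFact⇒value t isFact
    uniquelyFactored : UniquelyFactored t
    uniquelyFactored u value≡ = unique u (value⇒isFact u (trans value≡ value≡s))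
    minusF∉T : MinusF∉T t
    minusF∉T u value+F≡ = s-F∉S (value u , trans value+F≡ value≡s , inj₁ (u , value⇒isFact u refl))

  goodValues : List ℕ
  goodValues = map value goodTriples

  goodValues-unique : Unique goodValues
  goodValues-unique =
    map⁺-injectiveOn (λ g → good⇒uniquelyFactored g _) (All.tabulate ∈⇒good) goodTriples-unique

  goodValues-spec : ∀ s → (s ∈ goodValues) ⇔ (InAp a F s × UniqueFact a s)
  goodValues-spec s = mk⇔ to from
    where
    to : s ∈ goodValues → InAp a F s × UniqueFact a s
    to s∈ = let t , t∈ , s≡value = ∈-map⁻ value s∈ in
            subst (λ s → InAp a F s × UniqueFact a s) (sym s≡value) (good⇒apéry×unique (∈⇒good t∈))
    from : InAp a F s × UniqueFact a s → s ∈ goodValues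
    from s∈Ap×unique = let t , g , value≡s = apéry×unique⇒good s∈Ap×unique in
                       subst (_∈ goodValues) value≡s (∈-map⁺ value (good⇒∈ g))

  length-goodValues : length goodValues ≡ 6 * a ∸ 13
  length-goodValues = begin
    length (map value goodTriples)   ≡⟨ length-map value goodTriples ⟩
    length goodTriples               ≡⟨ length-goodTriples ⟩
    17 + 12 * m                      ≡⟨ m+n∸m≡n 13 (17 + 12 * m) ⟨
    13 + (17 + 12 * m) ∸ 13          ≡⟨ cong (_∸ 13) (6a≡13+17+12m m) ⟨
    6 * a ∸ 13                       ∎
    where
    open ≡-Reasoning
    6a≡13+17+12m : ∀ m → 6 * (5 + 2 * m) ≡ 13 + (17 + 12 * m)
    6a≡13+17+12m = solve-∀

odd⇒5+2m : ∀ {n} → 5 ≤ n → ¬ 2 ∣ n → ∃ λ m → n ≡ 5 + 2 * m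
odd⇒5+2m {n} 5≤n n-odd with halve n | halve-spec n
... | q , 0 | refl , _ = ⊥-elim (n-odd (divides q (trans (+-identityʳ (2 * q)) (*-comm 2 q))))
odd⇒5+2m (s≤s ()) _ | 0 , 1 | refl , _
odd⇒5+2m (s≤s (s≤s (s≤s ()))) _ | 1 , 1 | refl , _
... | suc (suc m) , 1 | refl , _ = m , 2[2+m]+1≡5+2m m
  where
  2[2+m]+1≡5+2m : ∀ m → 2 * (2 + m) + 1 ≡ 5 + 2 * m
  2[2+m]+1≡5+2m = solve-∀
... | _ , suc (suc _) | _ , s≤s ()

mainTheorem6 : (n : ℕ) → 5 ≤ n → ¬ (2 ∣ n) →
    Σ ℕ λ F → IsFrobenius n F ×
      Σ (List ℕ) λ L → Unique L ×
        (∀ s → (s ∈ L) ⇔ (InAp n F s × UniqueFact n s)) ×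
        length L ≡ 6 * n ∸ 13
mainTheorem6 n 5≤n n-odd with odd⇒5+2m 5≤n n-odd
... | m , refl = F m , isFrobenius m , goodValues m , goodValues-unique m , goodValues-spec m , length-goodValues m
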